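{- There is a constant $c$ such that for every finite field $\mathbb{F}_q$, $\widehat{S}(\mathrm{BW}_{G_q})\le c$; that is, $\widehat{S}(\mathrm{BW}_{G_q})=O(1)$.
   Context: For $(i,j)\in\mathbb{F}_q^2$ let $\ell_{(i,j)}=\{(t,i+jt):t\in\mathbb{F}_q\}$. $G_q$ is the bipartite graph with parts $A=B=\mathbb{F}_q^2$ in which $a\in A$ is adjacent to $b\in B$ iff $a\in\ell_b$. For $x\subseteq A$, $\mathrm{N}(x)\subseteq B$ is its neighbourhood. $\mathrm{BW}_{G_q}:\{0,1\}^A\times\{0,1\}^B\to\{0,1\}$ (a Boolean function on $n=2q^2$ variables) treats $x,y$ as subsets and equals $1$ iff $\mathrm{N}(x)\cap y\neq\emptyset$. For $f:\{0,1\}^n\to\{0,1\}$ and $D\subseteq[n]$, $f_D$ is the matrix with rows indexed by $\alpha\in\{0,1\}^D$, columns by assignments to the complement, entry the value of $f$; $\mathsf{mult}(f_D)$ is the number of occurrences of a most frequent row; $\widehat{S}(f)=\max_{1\le k\le n}\min_{|D|=k}2^k/\mathsf{mult}(f_D)$. -}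

module Defs where

open import Level using (0ℓ)
open import Data.Bool using (Bool; true; false; _∧_; _∨_; if_then_else_)
open import Data.Nat as ℕ using (ℕ; zero; suc; _^_; _≡ᵇ_)
open import Data.Fin as Fin using (Fin; splitAt; remQuot)
open import Data.Fin.Subset using (Subset; ∣_∣)
open import Data.Vec as Vec using (Vec; []; _∷_; lookup)
open import Data.List as List using (List; []; _∷_; map; filter; length; allFin; foldr; concatMap; upTo)
open import Data.Bool.ListAction using (any; all)
open import Data.Product using (_×_; _,_; ∃)
open import Data.Sum using (_⊎_; inj₁; inj₂)
open import Data.Integer using (+_)
open import Data.Rational as ℚ using (ℚ; 0ℚ; _/_)
open import Relation.Nullary using (¬_; does)
open import Relation.Nullary.Decidable using (⌊_⌋)
open import Relation.Binary.PropositionalEquality using (_≡_)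
open import Algebra.Structures using (IsCommutativeRing)

-- Finite fields.  A finite field with q elements is presented (up to
-- isomorphism) as a field structure on the carrier Fin q.

record FiniteField : Set where
  field
    q        : ℕ
    _+F_     : Fin q → Fin q → Fin q
    _*F_     : Fin q → Fin q → Fin q
    -F_      : Fin q → Fin q
    0F       : Fin q
    1F       : Fin q
    isCommRing : IsCommutativeRing _≡_ _+F_ _*F_ -F_ 0F 1F
    0≢1      : ¬ (0F ≡ 1F)
    inverse  : ∀ x → ¬ (x ≡ 0F) → ∃ λ y → x *F y ≡ 1F

BoolFun : ℕ → Set
BoolFun n = Vec Bool n → Bool

allVecs : (n : ℕ) → List (Vec Bool n)
allVecs zero    = [] ∷ []
allVecs (suc n) = concatMap (λ v → (false ∷ v) ∷ (true ∷ v) ∷ []) (allVecs n)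

zeroOutside : ∀ {n} → Subset n → Vec Bool n → Bool
zeroOutside []          []       = true
zeroOutside (true ∷ s)  (_ ∷ v)  = zeroOutside s v
zeroOutside (false ∷ s) (b ∷ v)  = Data.Bool.not b ∧ zeroOutside s v
  where import Data.Bool

complementS : ∀ {n} → Subset n → Subset n
complementS = Vec.map Data.Bool.not
  where import Data.Bool

-- assignments to the variables in D (encoded as vectors vanishing off D)
assignments : ∀ {n} → Subset n → List (Vec Bool n)
assignments {n} D = filter (λ v → Data.Bool._≟_ (zeroOutside D v) true) (allVecs n)
  where import Data.Bool

merge : ∀ {n} → Subset n → Vec Bool n → Vec Bool n → Vec Bool n
merge D α β = Vec.zipWith (λ d ab → if d then Data.Product.proj₁ ab else Data.Product.proj₂ ab) D (Vec.zip α β)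
  where import Data.Product

_==_ : Bool → Bool → Bool
true  == b = b
false == b = Data.Bool.not b
  where import Data.Bool

sameRow : ∀ {n} → BoolFun n → Subset n → Vec Bool n → Vec Bool n → Bool
sameRow f D α α' = all (λ β → f (merge D α β) == f (merge D α' β)) (assignments (complementS D))

maxℕ : List ℕ → ℕ
maxℕ = foldr ℕ._⊔_ 0

-- mult(f_D): number of occurrences of a most frequent row of f_D
mult : ∀ {n} → BoolFun n → Subset n → ℕ
mult f D = maxℕ (map (λ α → length (filter (λ α' → Data.Bool._≟_ (sameRow f D α α') true) (assignments D))) (assignments D))
  where import Data.Bool

-- a / b as a rational (b = 0 never occurs below since mult ≥ 1)
ratio : ℕ → ℕ → ℚ
ratio a zero    = 0ℚ
ratio a (suc b) = (+ a) / suc b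

maxℚ : List ℚ → ℚ
maxℚ []       = 0ℚ
maxℚ (x ∷ xs) = foldr ℚ._⊔_ x xs

minℚ : List ℚ → ℚ
minℚ []       = 0ℚ
minℚ (x ∷ xs) = foldr ℚ._⊓_ x xs

subsetsOfSize : (n k : ℕ) → List (Subset n)
subsetsOfSize n k = filter (λ D → ∣ D ∣ ℕ.≟ k) (allVecs n)

Shat : ∀ {n} → BoolFun n → ℚ
Shat {n} f = maxℚ (map (λ k → minℚ (map (λ D → ratio (2 ^ k) (mult f D)) (subsetsOfSize n k)))
                       (map suc (upTo n)))

module _ (F : FiniteField) where
  open FiniteField F

  Pt : Set
  Pt = Fin q × Fin q

  -- a = (a₁,a₂) ∈ ℓ_{(i,j)} = {(t, i + j t)}  iff  a₂ = i + j a₁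
  adjacent : Pt → Pt → Bool
  adjacent (a₁ , a₂) (i , j) = ⌊ a₂ Fin.≟ (i +F (j *F a₁)) ⌋

  allPts : List Pt
  allPts = concatMap (λ s → map (λ t → s , t) (allFin q)) (allFin q)

  nVars : ℕ
  nVars = q ℕ.* q ℕ.+ q ℕ.* q

  -- variables 0..q²-1 index A (via combine), variables q²..2q²-1 index B

  -- BW_{G_q}(x,y) = 1 iff N(x) ∩ y ≠ ∅
  BW : BoolFun nVars
  BW v = any (λ a → any (λ b → lookup v (Fin._↑ˡ_ (Fin.combine (Data.Product.proj₁ a) (Data.Product.proj₂ a)) (q ℕ.* q))
                              ∧ lookup v (Fin._↑ʳ_ (q ℕ.* q) (Fin.combine (Data.Product.proj₁ b) (Data.Product.proj₂ b)))
                              ∧ adjacent a b) allPts) allPts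
    where import Data.Product

-- BW_{G_q} has a 1-certificate of size two: if a ∈ ℓ_b, setting x_a = y_b = 1 forces the value 1.
-- Any f with such a certificate {i, j} has Ŝ(f) ≤ 4. For k ≥ 2 take D ⊇ {i, j} of size k: the
-- 2^(k-2) rows α of f_D with α i = α j = 1 all coincide with the constant-1 row, so
-- 2^k / mult(f_D) ≤ 4; for k = 1 already mult(f_D) ≥ 1. Thus every inner minimum in Ŝ is at most 4.
module Submission where

open import Defs
open import Data.Bool using (Bool; true; false; not; _∧_; T; _≟_)
open import Data.Bool.Properties using (T-≡)
open import Data.Nat as ℕ using (ℕ; zero; suc; _+_; _*_; _^_; _≤_; _<_; _⊔_; z≤n; s≤s)
import Data.Nat.Properties as ℕP
open import Data.Integer as ℤ using (+_)
import Data.Integer.Properties as ℤP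
open import Data.Rational as ℚ using (0ℚ; _/_; _⊓_)
import Data.Rational.Properties as ℚP
open import Data.Rational.Unnormalised as ℚᵘ using (mkℚᵘ)
import Data.Rational.Unnormalised.Properties as ℚᵘP
open import Data.Fin as Fin using (Fin)
import Data.Fin.Properties as FP
open import Data.Fin.Subset using (Subset; ∣_∣)
open import Data.Vec as Vec using (Vec; []; _∷_; lookup; replicate; _[_]≔_)
open import Data.Vec.Properties using (lookup-map; lookup-replicate; lookup∘update; lookup∘update′)
open import Data.List as List using (List; []; _∷_; map; filter; length; upTo; allFin; concatMap)
open import Data.List.Properties using (filter-idem; foldr-preservesᵇ; foldr-preservesᵒ)
open import Data.List.Relation.Unary.All as All using (All; []; _∷_)
open import Data.List.Relation.Unary.All.Properties using (all⁻) renaming (map⁺ to All-map⁺)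
open import Data.List.Relation.Unary.Any as Any using (here; there)
open import Data.List.Relation.Unary.Any.Properties using (any⁺)
open import Data.List.Membership.Propositional using (_∈_)
open import Data.List.Membership.Propositional.Properties
  using (∈-map⁺; ∈-filter⁺; ∈-upTo⁻; ∈-concatMap⁺; ∈-allFin)
open import Data.List.Relation.Binary.Sublist.Propositional using (_⊆_; ⊆-refl)
open import Data.List.Relation.Binary.Sublist.Propositional.Properties using (filter⁺; length-mono-≤)
open import Data.Product using (∃; _×_; _,_)
open import Data.Sum using (_⊎_; inj₁; inj₂; [_,_])
open import Function.Base using (_∘_)
open import Function.Bundles using (Equivalence)
open import Relation.Nullary using (Dec)
import Relation.Nullary.Decidable as Dec
open import Relation.Binary.PropositionalEquality
  using (_≡_; _≢_; refl; sym; trans; cong; subst; subst₂; module ≡-Reasoning)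
open import Algebra.Structures using (IsCommutativeRing)

-- (+ a) / suc b is fromℚᵘ (mkℚᵘ (+ a) b), so it suffices to cross-multiply the unnormalised fractions.
/-≤ : ∀ a b c → a ≤ c * suc b → (+ a) / suc b ℚ.≤ (+ c) / 1
/-≤ a b c a≤cb = ℚP.toℚᵘ-cancel-≤
  (ℚᵘP.≤-respʳ-≃ (ℚᵘP.≃-sym (ℚP.toℚᵘ-fromℚᵘ (mkℚᵘ (+ c) 0)))
    (ℚᵘP.≤-respˡ-≃ (ℚᵘP.≃-sym (ℚP.toℚᵘ-fromℚᵘ (mkℚᵘ (+ a) b)))
      (ℚᵘ.*≤* (subst₂ ℤ._≤_ (sym (ℤP.*-identityʳ (+ a))) (ℤP.pos-* c (suc b)) (ℤ.+≤+ a≤cb)))))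

0≤/1 : ∀ c → 0ℚ ℚ.≤ (+ c) / 1
0≤/1 c = /-≤ 0 0 c z≤n

ratio-≤ : ∀ a m c → a ≤ c * m → ratio a m ℚ.≤ (+ c) / 1
ratio-≤ a zero    c _    = 0≤/1 c
ratio-≤ a (suc b) c a≤cm = /-≤ a b c a≤cm

minℚ-≤ : ∀ {x xs} → x ∈ xs → minℚ xs ℚ.≤ x
minℚ-≤ {x} {y ∷ ys} x∈ = foldr-preservesᵒ {P = ℚ._≤ x} lower y ys (from∈ x∈)
  where
  lower : ∀ a b → a ℚ.≤ x ⊎ b ℚ.≤ x → a ⊓ b ℚ.≤ x
  lower a b = [ ℚP.p≤q⇒p⊓r≤q b , ℚP.p≤q⇒r⊓p≤q a ]
  from∈ : x ∈ y ∷ ys → y ℚ.≤ x ⊎ Any.Any (ℚ._≤ x) ys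
  from∈ (here refl)  = inj₁ ℚP.≤-refl
  from∈ (there x∈ys) = inj₂ (Any.map (λ { refl → ℚP.≤-refl }) x∈ys)

maxℚ-≤ : ∀ {c} xs → 0ℚ ℚ.≤ c → All (ℚ._≤ c) xs → maxℚ xs ℚ.≤ c
maxℚ-≤ []       0≤c []         = 0≤c
maxℚ-≤ (x ∷ xs) _   (x≤c ∷ xs≤c) = foldr-preservesᵇ ℚP.⊔-lub x≤c xs≤c

≤-maxℕ : ∀ {x xs} → x ∈ xs → x ≤ maxℕ xs
≤-maxℕ {x} {xs} x∈ = foldr-preservesᵒ {P = x ≤_} upper 0 xs (inj₂ (Any.map (λ { refl → ℕP.≤-refl }) x∈))
  where
  upper : ∀ a b → x ≤ a ⊎ x ≤ b → x ≤ a ⊔ b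
  upper a b = [ ℕP.m≤n⇒m≤n⊔o b , ℕP.m≤n⇒m≤o⊔n a ]

bothExtensions : ∀ {n} → Vec Bool n → List (Vec Bool (suc n))
bothExtensions v = (false ∷ v) ∷ (true ∷ v) ∷ []

allVecs-complete : ∀ {n} (v : Vec Bool n) → v ∈ allVecs n
allVecs-complete []      = here refl
allVecs-complete (b ∷ v) = ∈-concatMap⁺ bothExtensions (Any.map (λ { refl → cons∈ b }) (allVecs-complete v))
  where
  cons∈ : ∀ b → (b ∷ v) ∈ bothExtensions v
  cons∈ false = here refl
  cons∈ true  = there (here refl)

Shat-≤ : ∀ {n} (f : BoolFun n) c →
         (∀ k → 0 < k → k ≤ n → ∃ λ D → ∣ D ∣ ≡ k × 2 ^ k ≤ c * mult f D) →
         Shat f ℚ.≤ (+ c) / 1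
Shat-≤ {n} f c good = maxℚ-≤ _ (0≤/1 c) (All-map⁺ (All-map⁺ (All.tabulate inner)))
  where
  inner : ∀ {i} → i ∈ upTo n →
          minℚ (map (λ D → ratio (2 ^ suc i) (mult f D)) (subsetsOfSize n (suc i))) ℚ.≤ (+ c) / 1
  inner {i} i∈ with good (suc i) (s≤s z≤n) (∈-upTo⁻ i∈)
  ... | D , ∣D∣≡k , bound = ℚP.≤-trans (minℚ-≤ (∈-map⁺ _ D∈)) (ratio-≤ _ _ c bound)
    where
    D∈ : D ∈ subsetsOfSize n (suc i)
    D∈ = ∈-filter⁺ (λ D → ∣ D ∣ ℕ.≟ suc i) (allVecs-complete D) ∣D∣≡k

-- A pattern p : Pattern n describes a subcube of assignments to D = support p: free cells vary,
-- forced cells are 1, and excluded cells lie outside D (where assignments are 0 by convention).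
data Cell : Set where
  free forced excluded : Cell

Pattern : ℕ → Set
Pattern = Vec Cell

inSupport : Cell → Bool
inSupport excluded = false
inSupport _        = true

support : ∀ {n} → Pattern n → Subset n
support = Vec.map inSupport

#free : ∀ {n} → Pattern n → ℕ
#free []             = 0
#free (free ∷ p)     = suc (#free p)
#free (forced ∷ p)   = #free p
#free (excluded ∷ p) = #free p

#excluded : ∀ {n} → Pattern n → ℕ
#excluded []             = 0
#excluded (free ∷ p)     = #excluded p
#excluded (forced ∷ p)   = #excluded p
#excluded (excluded ∷ p) = suc (#excluded p)

matches : ∀ {n} → Pattern n → Vec Bool n → Bool
matches []             []      = true
matches (free ∷ p)     (_ ∷ v) = matches p v
matches (forced ∷ p)   (b ∷ v) = b ∧ matches p v
matches (excluded ∷ p) (b ∷ v) = not b ∧ matches p v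

countTrue : ∀ {A : Set} → (A → Bool) → List A → ℕ
countTrue P xs = length (filter (λ x → P x ≟ true) xs)

weight : Cell → ℕ
weight free = 2
weight _    = 1

countTrue-matches-∷ : ∀ {n} c (p : Pattern n) vs →
  countTrue (matches (c ∷ p)) (concatMap bothExtensions vs) ≡ weight c * countTrue (matches p) vs
countTrue-matches-∷ c p [] = sym (ℕP.*-zeroʳ (weight c))
countTrue-matches-∷ free p (v ∷ vs) with matches p v in eq
... | true  rewrite eq = trans (cong (λ k → suc (suc k)) (countTrue-matches-∷ free p vs)) (sym (ℕP.*-suc 2 _))
... | false rewrite eq = countTrue-matches-∷ free p vs
countTrue-matches-∷ forced p (v ∷ vs) with matches p v
... | true  = cong suc (countTrue-matches-∷ forced p vs)
... | false = countTrue-matches-∷ forced p vs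
countTrue-matches-∷ excluded p (v ∷ vs) with matches p v
... | true  = cong suc (countTrue-matches-∷ excluded p vs)
... | false = countTrue-matches-∷ excluded p vs

countTrue-matches : ∀ {n} (p : Pattern n) → countTrue (matches p) (allVecs n) ≡ 2 ^ #free p
countTrue-matches []                = refl
countTrue-matches {suc n} (c ∷ p) = begin
  countTrue (matches (c ∷ p)) (allVecs (suc n)) ≡⟨ countTrue-matches-∷ c p (allVecs n) ⟩
  weight c * countTrue (matches p) (allVecs n)  ≡⟨ cong (weight c *_) (countTrue-matches p) ⟩
  weight c * 2 ^ #free p                        ≡⟨ weight-^ c ⟩
  2 ^ #free (c ∷ p)                             ∎
  where
  open ≡-Reasoning
  weight-^ : ∀ c → weight c * 2 ^ #free p ≡ 2 ^ #free (c ∷ p)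
  weight-^ free     = refl
  weight-^ forced   = ℕP.+-identityʳ _
  weight-^ excluded = ℕP.+-identityʳ _

isForced : Cell → Bool
isForced forced = true
isForced _      = false

witness : ∀ {n} → Pattern n → Vec Bool n
witness = Vec.map isForced

matches-witness : ∀ {n} (p : Pattern n) → matches p (witness p) ≡ true
matches-witness []             = refl
matches-witness (free ∷ p)     = matches-witness p
matches-witness (forced ∷ p)   = matches-witness p
matches-witness (excluded ∷ p) = matches-witness p

matches⇒zeroOutside : ∀ {n} (p : Pattern n) v → matches p v ≡ true → zeroOutside (support p) v ≡ true
matches⇒zeroOutside []             []           _ = refl
matches⇒zeroOutside (free ∷ p)     (_ ∷ v)      m = matches⇒zeroOutside p v m
matches⇒zeroOutside (forced ∷ p)   (true ∷ v)   m = matches⇒zeroOutside p v m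
matches⇒zeroOutside (excluded ∷ p) (false ∷ v)  m = matches⇒zeroOutside p v m

matches-forced : ∀ {n} (p : Pattern n) v x → matches p v ≡ true → lookup p x ≡ forced → lookup v x ≡ true
matches-forced (forced ∷ p)   (true ∷ v)  Fin.zero    _ _ = refl
matches-forced (free ∷ p)     (_ ∷ v)     (Fin.suc x) m e = matches-forced p v x m e
matches-forced (forced ∷ p)   (true ∷ v)  (Fin.suc x) m e = matches-forced p v x m e
matches-forced (excluded ∷ p) (false ∷ v) (Fin.suc x) m e = matches-forced p v x m e

matches-unique : ∀ {n} (p : Pattern n) u v → #free p ≡ 0 →
                 matches p u ≡ true → matches p v ≡ true → u ≡ v
matches-unique []             []          []          _ _ _ = refl
matches-unique (forced ∷ p)   (true ∷ u)  (true ∷ v)  z m m′ = cong (true ∷_) (matches-unique p u v z m m′)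
matches-unique (excluded ∷ p) (false ∷ u) (false ∷ v) z m m′ = cong (false ∷_) (matches-unique p u v z m m′)

merge-lookup : ∀ {n} (D : Subset n) α β x → lookup D x ≡ true → lookup (merge D α β) x ≡ lookup α x
merge-lookup (true ∷ D) (a ∷ α) (b ∷ β) Fin.zero    _ = refl
merge-lookup (_ ∷ D)    (a ∷ α) (b ∷ β) (Fin.suc x) e = merge-lookup D α β x e

==-refl : ∀ b → (b == b) ≡ true
==-refl true  = refl
==-refl false = refl

sameRow-intro : ∀ {n} (f : BoolFun n) D α α′ →
  (∀ β → f (merge D α β) ≡ f (merge D α′ β)) → sameRow f D α α′ ≡ true
sameRow-intro f D α α′ same = Equivalence.to T-≡ (all⁻ _ {xs = assignments (complementS D)} (All.tabulate agree))
  where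
  agree : ∀ {β} → β ∈ assignments (complementS D) → T (f (merge D α β) == f (merge D α′ β))
  agree {β} _ = Equivalence.from T-≡
    (subst (λ b → (f (merge D α β) == b) ≡ true) (same β) (==-refl (f (merge D α β))))

RowsAgree : ∀ {n} → BoolFun n → Pattern n → Set
RowsAgree f p = ∀ u v → matches p u ≡ true → matches p v ≡ true → sameRow f (support p) u v ≡ true

mult-≥ : ∀ {n} (f : BoolFun n) (p : Pattern n) → RowsAgree f p → 2 ^ #free p ≤ mult f (support p)
mult-≥ {n} f p rows = begin
  2 ^ #free p                                             ≡⟨ countTrue-matches p ⟨
  countTrue (matches p) (allVecs n)                       ≤⟨ length-mono-≤ matched⊆row ⟩
  countTrue (sameRow f D (witness p)) (assignments D)     ≤⟨ ≤-maxℕ (∈-map⁺ _ witness∈) ⟩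
  mult f D                                                ∎
  where
  open ℕP.≤-Reasoning
  D : Subset n
  D = support p
  M? Z? R? : ∀ v → Dec (_ ≡ true)
  M? v = matches p v ≟ true
  Z? v = zeroOutside D v ≟ true
  R? v = sameRow f D (witness p) v ≟ true
  w-matches : matches p (witness p) ≡ true
  w-matches = matches-witness p
  witness∈ : witness p ∈ assignments D
  witness∈ = ∈-filter⁺ Z? (allVecs-complete (witness p)) (matches⇒zeroOutside p _ w-matches)
  matched⊆row : filter M? (allVecs n) ⊆ filter R? (assignments D)
  matched⊆row = subst (_⊆ filter R? (assignments D)) (filter-idem M? (allVecs n))
    (filter⁺ M? R? (λ { refl m → rows _ _ w-matches m })
      (filter⁺ M? Z? (λ { refl m → matches⇒zeroOutside p _ m }) (⊆-refl {x = allVecs n})))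

∣support∣+#excluded : ∀ {n} (p : Pattern n) → ∣ support p ∣ + #excluded p ≡ n
∣support∣+#excluded []             = refl
∣support∣+#excluded (free ∷ p)     = cong suc (∣support∣+#excluded p)
∣support∣+#excluded (forced ∷ p)   = cong suc (∣support∣+#excluded p)
∣support∣+#excluded (excluded ∷ p) = trans (ℕP.+-suc _ _) (cong suc (∣support∣+#excluded p))

∣support-replicate∣ : ∀ n → ∣ support (replicate n excluded) ∣ ≡ 0
∣support-replicate∣ zero    = refl
∣support-replicate∣ (suc n) = ∣support-replicate∣ n

#free-replicate : ∀ n → #free (replicate n excluded) ≡ 0
#free-replicate zero    = refl
#free-replicate (suc n) = #free-replicate n

∣support-force∣ : ∀ {n} (p : Pattern n) i → lookup p i ≡ excluded →
                  ∣ support (p [ i ]≔ forced) ∣ ≡ suc ∣ support p ∣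
∣support-force∣ (excluded ∷ p) Fin.zero    _ = refl
∣support-force∣ (free ∷ p)     (Fin.suc i) e = cong suc (∣support-force∣ p i e)
∣support-force∣ (forced ∷ p)   (Fin.suc i) e = cong suc (∣support-force∣ p i e)
∣support-force∣ (excluded ∷ p) (Fin.suc i) e = ∣support-force∣ p i e

#free-force : ∀ {n} (p : Pattern n) i → lookup p i ≡ excluded → #free (p [ i ]≔ forced) ≡ #free p
#free-force (excluded ∷ p) Fin.zero    _ = refl
#free-force (free ∷ p)     (Fin.suc i) e = cong suc (#free-force p i e)
#free-force (forced ∷ p)   (Fin.suc i) e = #free-force p i e
#free-force (excluded ∷ p) (Fin.suc i) e = #free-force p i e

freeFirst : ∀ {n} → ℕ → Pattern n → Pattern n
freeFirst zero    p              = p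
freeFirst (suc m) []             = []
freeFirst (suc m) (excluded ∷ p) = free ∷ freeFirst m p
freeFirst (suc m) (c ∷ p)        = c ∷ freeFirst (suc m) p

∣support-freeFirst∣ : ∀ {n} m (p : Pattern n) → m ≤ #excluded p →
                      ∣ support (freeFirst m p) ∣ ≡ ∣ support p ∣ + m
∣support-freeFirst∣ zero    p              _       = sym (ℕP.+-identityʳ _)
∣support-freeFirst∣ (suc m) (free ∷ p)     m≤     = cong suc (∣support-freeFirst∣ (suc m) p m≤)
∣support-freeFirst∣ (suc m) (forced ∷ p)   m≤     = cong suc (∣support-freeFirst∣ (suc m) p m≤)
∣support-freeFirst∣ (suc m) (excluded ∷ p) (s≤s m≤) =
  trans (cong suc (∣support-freeFirst∣ m p m≤)) (sym (ℕP.+-suc _ m))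

#free-freeFirst : ∀ {n} m (p : Pattern n) → m ≤ #excluded p → #free (freeFirst m p) ≡ #free p + m
#free-freeFirst zero    p              _        = sym (ℕP.+-identityʳ _)
#free-freeFirst (suc m) (free ∷ p)     m≤       = cong suc (#free-freeFirst (suc m) p m≤)
#free-freeFirst (suc m) (forced ∷ p)   m≤       = #free-freeFirst (suc m) p m≤
#free-freeFirst (suc m) (excluded ∷ p) (s≤s m≤) =
  trans (cong suc (#free-freeFirst m p m≤)) (sym (ℕP.+-suc _ m))

freeFirst-forced : ∀ {n} m (p : Pattern n) x → lookup p x ≡ forced → lookup (freeFirst m p) x ≡ forced
freeFirst-forced zero    p              x           e = e
freeFirst-forced (suc m) (forced ∷ p)   Fin.zero    _ = refl
freeFirst-forced (suc m) (free ∷ p)     (Fin.suc x) e = freeFirst-forced (suc m) p x e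
freeFirst-forced (suc m) (forced ∷ p)   (Fin.suc x) e = freeFirst-forced (suc m) p x e
freeFirst-forced (suc m) (excluded ∷ p) (Fin.suc x) e = freeFirst-forced m p x e

rowsAgree-rigid : ∀ {n} (f : BoolFun n) (p : Pattern n) → #free p ≡ 0 → RowsAgree f p
rowsAgree-rigid f p rigid u v mu mv rewrite matches-unique p u v rigid mu mv =
  sameRow-intro f (support p) v v (λ _ → refl)

module _ {n} (f : BoolFun n) {i j : Fin n} (i≢j : i ≢ j)
         (certificate : ∀ v → lookup v i ≡ true → lookup v j ≡ true → f v ≡ true) where

  private
    none : Pattern n
    none = replicate n excluded

    forcedᵢ : Pattern n
    forcedᵢ = none [ i ]≔ forced

    forcedᵢⱼ : Pattern n
    forcedᵢⱼ = forcedᵢ [ j ]≔ forced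

    ∣support-forcedᵢ∣ : ∣ support forcedᵢ ∣ ≡ 1
    ∣support-forcedᵢ∣ = trans (∣support-force∣ none i (lookup-replicate i excluded)) (cong suc (∣support-replicate∣ n))

    #free-forcedᵢ : #free forcedᵢ ≡ 0
    #free-forcedᵢ = trans (#free-force none i (lookup-replicate i excluded)) (#free-replicate n)

    j-excluded : lookup forcedᵢ j ≡ excluded
    j-excluded = trans (lookup∘update′ (i≢j ∘ sym) none forced) (lookup-replicate j excluded)

    ∣support-forcedᵢⱼ∣ : ∣ support forcedᵢⱼ ∣ ≡ 2
    ∣support-forcedᵢⱼ∣ = trans (∣support-force∣ forcedᵢ j j-excluded) (cong suc ∣support-forcedᵢ∣)

    #free-forcedᵢⱼ : #free forcedᵢⱼ ≡ 0
    #free-forcedᵢⱼ = trans (#free-force forcedᵢ j j-excluded) #free-forcedᵢ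

    forcedᵢⱼ-i : lookup forcedᵢⱼ i ≡ forced
    forcedᵢⱼ-i = trans (lookup∘update′ i≢j forcedᵢ forced) (lookup∘update i none forced)

    forcedᵢⱼ-j : lookup forcedᵢⱼ j ≡ forced
    forcedᵢⱼ-j = lookup∘update j forcedᵢ forced

    2+#excluded : 2 + #excluded forcedᵢⱼ ≡ n
    2+#excluded = trans (cong (_+ #excluded forcedᵢⱼ) (sym ∣support-forcedᵢⱼ∣)) (∣support∣+#excluded forcedᵢⱼ)

    rowsAgree-certified : ∀ (p : Pattern n) → lookup p i ≡ forced → lookup p j ≡ forced → RowsAgree f p
    rowsAgree-certified p pi pj u v mu mv = sameRow-intro f D u v λ β → trans (one u mu β) (sym (one v mv β))
      where
      D : Subset n
      D = support p
      in-D : ∀ {x} → lookup p x ≡ forced → lookup D x ≡ true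
      in-D {x} e = trans (lookup-map x inSupport p) (cong inSupport e)
      at : ∀ w → matches p w ≡ true → ∀ β {x} → lookup p x ≡ forced → lookup (merge D w β) x ≡ true
      at w mw β e = trans (merge-lookup D w β _ (in-D e)) (matches-forced p w _ mw e)
      one : ∀ w → matches p w ≡ true → ∀ β → f (merge D w β) ≡ true
      one w mw β = certificate (merge D w β) (at w mw β pi) (at w mw β pj)

    large-mult-subset : ∀ k → 0 < k → k ≤ n → ∃ λ D → ∣ D ∣ ≡ k × 2 ^ k ≤ 4 * mult f D
    large-mult-subset zero () _
    large-mult-subset (suc zero) _ _ = support forcedᵢ , ∣support-forcedᵢ∣ ,
      ℕP.*-mono-≤ (ℕP.m≤m+n 2 2) (subst (λ e → 2 ^ e ≤ mult f (support forcedᵢ)) #free-forcedᵢ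
        (mult-≥ f forcedᵢ (rowsAgree-rigid f forcedᵢ #free-forcedᵢ)))
    large-mult-subset (suc (suc m)) _ k≤n = support p , size , bound
      where
      p : Pattern n
      p = freeFirst m forcedᵢⱼ
      m≤ : m ≤ #excluded forcedᵢⱼ
      m≤ = ℕP.+-cancelˡ-≤ 2 m _ (subst (suc (suc m) ≤_) (sym 2+#excluded) k≤n)
      size : ∣ support p ∣ ≡ 2 + m
      size = trans (∣support-freeFirst∣ m forcedᵢⱼ m≤) (cong (_+ m) ∣support-forcedᵢⱼ∣)
      #free-p : #free p ≡ m
      #free-p = trans (#free-freeFirst m forcedᵢⱼ m≤) (cong (_+ m) #free-forcedᵢⱼ)
      rows : 2 ^ m ≤ mult f (support p)
      rows = subst (λ e → 2 ^ e ≤ mult f (support p)) #free-p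
        (mult-≥ f p (rowsAgree-certified p (freeFirst-forced m _ i forcedᵢⱼ-i) (freeFirst-forced m _ j forcedᵢⱼ-j)))
      bound : 2 ^ (2 + m) ≤ 4 * mult f (support p)
      bound = subst (_≤ 4 * mult f (support p)) (ℕP.*-assoc 2 2 (2 ^ m)) (ℕP.*-monoʳ-≤ 4 rows)

  Shat≤4 : Shat f ℚ.≤ (+ 4) / 1
  Shat≤4 = Shat-≤ f 4 large-mult-subset

module _ (F : FiniteField) where
  open FiniteField F
  open IsCommutativeRing isCommRing using (zeroˡ; +-identityʳ)

  origin : Pt F
  origin = 0F , 0F

  -- x₀ and y₀ are the variables of (0,0) ∈ A and (0,0) ∈ B; they form an edge since (0,0) ∈ ℓ_(0,0).
  x₀ y₀ : Fin (nVars F)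
  x₀ = Fin.combine 0F 0F Fin.↑ˡ (q * q)
  y₀ = (q * q) Fin.↑ʳ Fin.combine 0F 0F

  x₀≢y₀ : x₀ ≢ y₀
  x₀≢y₀ x₀≡y₀ with () ← trans (sym (FP.splitAt-↑ˡ (q * q) _ (q * q)))
                       (trans (cong (Fin.splitAt (q * q)) x₀≡y₀) (FP.splitAt-↑ʳ (q * q) (q * q) _))

  origin-adjacent : T (adjacent F origin origin)
  origin-adjacent = Dec.fromWitness (sym (trans (cong (0F +F_) (zeroˡ 0F)) (+-identityʳ 0F)))

  origin∈allPts : origin ∈ allPts F
  origin∈allPts = ∈-concatMap⁺ (λ s → map (s ,_) (allFin q))
    (Any.map (λ { refl → ∈-map⁺ (0F ,_) (∈-allFin 0F) }) (∈-allFin 0F))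

  BW-certificate : ∀ v → lookup v x₀ ≡ true → lookup v y₀ ≡ true → BW F v ≡ true
  BW-certificate v vx vy = Equivalence.to T-≡
    (any⁺ _ (Any.map (λ { refl → any⁺ _ (Any.map (λ { refl → edge }) origin∈allPts) }) origin∈allPts))
    where
    edge : T (lookup v x₀ ∧ lookup v y₀ ∧ adjacent F origin origin)
    edge rewrite vx | vy = origin-adjacent

theorem6p6 : ∃ λ (c : ℕ) → (F : FiniteField) → Shat (BW F) ℚ.≤ (+ c) / 1
theorem6p6 = 4 , λ F → Shat≤4 (BW F) (x₀≢y₀ F) (BW-certificate F)
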